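{- Let $$A = \begin{bmatrix} 0 & y^{ -1} & y^{ -1}z & 0\\ y & 0 & 0 & yz\\ y & 0 & 0 & 0\\ 0 & y^{ -1} & 0 & 0 \end{bmatrix},$$ a $4\times 4$ matrix whose entries are Laurent polynomials in the indeterminate $y$ and polynomials in the indeterminate $z$. Then for all integers $n>1$ and $0\le j\le n$, $$[y^0 z^j]\ \operatorname{tr}(A^{2n}) = 2\cdot \frac{2n}{2n-j}\cdot \binom{2n-j}{j}.$$
   Context: For a Laurent polynomial $P$ in $y,z$, $[y^a z^b]\,P$ denotes the coefficient of $y^a z^b$ in $P$; $\operatorname{tr}$ denotes the matrix trace. -}

module Defs where

open import Data.Nat as ℕ using (ℕ; zero; suc; _≤_; _∸_; NonZero)
open import Data.Nat.Properties as ℕP using (≤-trans; ∸-monoʳ-≤; m+n∸m≡n; +-identityʳ)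
open import Data.Integer as ℤ using (ℤ; +_; -[1+_])
open import Data.Fin using (Fin; zero; suc)
open import Data.Product using (_×_; _,_)
open import Data.List using (List; []; _∷_; _++_; concatMap; map)
open import Relation.Nullary using (yes; no)
open import Relation.Binary.PropositionalEquality using (_≡_; subst; sym)

-- Elements of ℤ[y, y⁻¹][z]: formal ℤ-linear combinations of monomials
-- c · y^a · z^b, represented as a finite list of terms (c , a , b).
-- Equality of polynomials is "same coefficients"; only `coeff` is used.
Poly : Set
Poly = List (ℤ × ℤ × ℕ)

mono : ℤ → ℤ → ℕ → Poly
mono c a b = (c , a , b) ∷ []

0P : Poly
0P = []

1P : Poly
1P = mono (+ 1) (+ 0) 0

_+P_ : Poly → Poly → Poly
p +P q = p ++ q

_*P_ : Poly → Poly → Poly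
p *P q = concatMap (λ { (c , a , b) → map (λ { (d , a' , b') → (c ℤ.* d , a ℤ.+ a' , b ℕ.+ b') }) q }) p

coeff : ℤ → ℕ → Poly → ℤ
coeff a b [] = + 0
coeff a b ((c , a' , b') ∷ p) with a ℤ.≟ a' | b ℕ.≟ b'
... | yes _ | yes _ = c ℤ.+ coeff a b p
... | _     | _     = coeff a b p

Mat : Set
Mat = Fin 4 → Fin 4 → Poly

sum4 : (Fin 4 → Poly) → Poly
sum4 f = f zero +P (f (suc zero) +P (f (suc (suc zero)) +P f (suc (suc (suc zero)))))

_*M_ : Mat → Mat → Mat
(M *M N) i k = sum4 (λ j → M i j *P N j k)

idN : ∀ {m} → Fin m → Fin m → Poly
idN zero zero = 1P
idN (suc i) (suc k) = idN i k
idN _ _ = 0P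

idM : Mat
idM = idN

_^M_ : Mat → ℕ → Mat
M ^M zero = idM
M ^M suc k = M *M (M ^M k)

tr : Mat → Poly
tr M = sum4 (λ i → M i i)

y : Poly
y = mono (+ 1) (+ 1) 0

y⁻¹ : Poly
y⁻¹ = mono (+ 1) -[1+ 0 ] 0

y⁻¹z : Poly
y⁻¹z = mono (+ 1) -[1+ 0 ] 1

yz : Poly
yz = mono (+ 1) (+ 1) 1

A : Mat
A zero zero = 0P
A zero (suc zero) = y⁻¹
A zero (suc (suc zero)) = y⁻¹z
A zero (suc (suc (suc zero))) = 0P
A (suc zero) zero = y
A (suc zero) (suc zero) = 0P
A (suc zero) (suc (suc zero)) = 0P
A (suc zero) (suc (suc (suc zero))) = yz
A (suc (suc zero)) zero = y
A (suc (suc zero)) (suc _) = 0P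
A (suc (suc (suc zero))) zero = 0P
A (suc (suc (suc zero))) (suc zero) = y⁻¹
A (suc (suc (suc zero))) (suc (suc _)) = 0P

2n∸j-nonZero : ∀ n j → 2 ≤ n → j ≤ n → NonZero (2 ℕ.* n ∸ j)
2n∸j-nonZero n j 2≤n j≤n = ℕ.>-nonZero (≤-trans (ℕP.≤-trans (ℕ.s≤s ℕ.z≤n) 2≤n) n≤)
  where
  eq : 2 ℕ.* n ∸ n ≡ n
  eq = subst (λ m → n ℕ.+ (n ℕ.+ 0) ∸ n ≡ m) (+-identityʳ n) (m+n∸m≡n n (n ℕ.+ 0))
  n≤ : n ≤ 2 ℕ.* n ∸ j
  n≤ = subst (_≤ 2 ℕ.* n ∸ j) eq (∸-monoʳ-≤ (2 ℕ.* n) j≤n)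

-- Write A i j = y^(w i - w j) · B i j with weights w = (0, 1, 1, 0) and B = A at y = 1, a matrix
-- with entries 0, 1, z.  Then (A^k) i l = y^(w i - w l) (B^k) i l, so the y⁰-part of tr A^{2n} is
-- tr B^{2n}.  B exchanges columns supported on {0, 3} and on {1, 2}, acting on the two nonzero
-- entries by (p, q) ↦ (p + z q, p); iterating from the unit vectors, the diagonal of B^{2n} is
-- (F_{2n+1}, F_{2n+1}, z F_{2n-1}, z F_{2n-1}) with Fibonacci polynomials [z^j] F_{m+1} = C(m-j, j).
-- So the trace is twice the Lucas coefficient C(2n-j, j) + C(2n-j-1, j-1), and the absorption
-- identity j C(N, j) = N C(N-1, j-1) turns (2n-j) times it into 2n C(2n-j, j).
module Submission where

open import Defs
open import Data.Nat using (ℕ; zero; suc; _+_; _*_; _∸_; _≤_; _<_; s≤s; z≤n; NonZero)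
import Data.Nat.Properties as ℕP
open import Data.Nat.Combinatorics using (_C_; nCk+nC[k+1]≡[n+1]C[k+1]; nC1≡n)
open import Data.Nat.Solver using (module +-*-Solver)
open import Data.Integer as ℤ using (ℤ; +_)
import Data.Integer.Properties as ℤP
open import Algebra.Properties.AbelianGroup ℤP.+-0-abelianGroup using (∙-cancelˡ)
open import Data.Rational using (_/_; toℚᵘ) renaming (_*_ to _*ℚ_)
import Data.Rational.Properties as ℚP
open import Data.Rational.Unnormalised using (mkℚᵘ; *≡*) renaming (_*_ to _*ᵘ_; _≃_ to _≃ᵘ_)
import Data.Rational.Unnormalised.Properties as ℚᵘP
open import Data.Fin using (Fin; suc)
open import Data.Fin.Patterns using (0F; 1F; 2F; 3F)
open import Data.Fin.Properties using (_≟_)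
open import Data.Bool using (if_then_else_)
open import Data.Product using (_,_)
open import Data.List using ([]; _∷_; _++_)
open import Relation.Nullary using (¬_; yes; no; does; contradiction)
open import Relation.Binary.PropositionalEquality

open +-*-Solver using (solve; _:=_; _:+_; _:*_; con)

coeff-++ : ∀ a b (p q : Poly) → coeff a b (p ++ q) ≡ coeff a b p ℤ.+ coeff a b q
coeff-++ a b [] q = sym (ℤP.+-identityˡ _)
coeff-++ a b ((c , a' , b') ∷ p) q with a ℤ.≟ a' | b ℕP.≟ b'
... | yes _ | yes _ = trans (cong (ℤ._+_ c) (coeff-++ a b p q)) (sym (ℤP.+-assoc c _ _))
... | yes _ | no _  = coeff-++ a b p q
... | no _  | _     = coeff-++ a b p q

coeff-sum4 : ∀ a b (f : Fin 4 → Poly) → coeff a b (sum4 f) ≡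
  coeff a b (f 0F) ℤ.+ (coeff a b (f 1F) ℤ.+ (coeff a b (f 2F) ℤ.+ coeff a b (f 3F)))
coeff-sum4 a b f =
  trans (coeff-++ a b (f 0F) _)
    (cong (ℤ._+_ (coeff a b (f 0F))) (trans (coeff-++ a b (f 1F) _)
      (cong (ℤ._+_ (coeff a b (f 1F))) (coeff-++ a b (f 2F) (f 3F)))))

coeff-mono-* : ∀ a₀ e a b q → coeff (a₀ ℤ.+ a) (e + b) (mono (+ 1) a₀ e *P q) ≡ coeff a b q
coeff-mono-* a₀ e a b [] = refl
coeff-mono-* a₀ e a b ((d , a' , b') ∷ q)
  with a ℤ.≟ a' | b ℕP.≟ b' | a₀ ℤ.+ a ℤ.≟ a₀ ℤ.+ a' | e + b ℕP.≟ e + b'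
... | yes refl | yes refl | yes _   | yes _   = cong₂ ℤ._+_ (ℤP.*-identityˡ d) (coeff-mono-* a₀ e a b q)
... | yes refl | _        | no a≢a  | _       = contradiction refl a≢a
... | _        | yes refl | _       | no b≢b  = contradiction refl b≢b
... | no a≢a'  | _        | yes eq  | _       = contradiction (∙-cancelˡ a₀ a a' eq) a≢a'
... | _        | no b≢b'  | _       | yes eq  = contradiction (ℕP.+-cancelˡ-≡ e b b' eq) b≢b'
... | yes _    | no _     | yes _   | no _    = coeff-mono-* a₀ e a b q
... | no _     | yes _    | no _    | yes _   = coeff-mono-* a₀ e a b q
... | no _     | no _     | no _    | no _    = coeff-mono-* a₀ e a b q

coeff-mono-*-below : ∀ a₀ e a b q → b < e → coeff a b (mono (+ 1) a₀ e *P q) ≡ + 0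
coeff-mono-*-below a₀ e a b [] b<e = refl
coeff-mono-*-below a₀ e a b ((d , a' , b') ∷ q) b<e with a ℤ.≟ a₀ ℤ.+ a' | b ℕP.≟ e + b'
... | yes _ | yes refl = contradiction b<e (ℕP.m+n≮m e b')
... | yes _ | no _     = coeff-mono-*-below a₀ e a b q b<e
... | no _  | _        = coeff-mono-*-below a₀ e a b q b<e

coeff-mono-*-telescope : ∀ u v w e b q →
  coeff (u ℤ.- w) (e + b) (mono (+ 1) (u ℤ.- v) e *P q) ≡ coeff (v ℤ.- w) b q
coeff-mono-*-telescope u v w e b q =
  trans (cong (λ a → coeff a (e + b) (mono (+ 1) (u ℤ.- v) e *P q)) (sym (ℤP.+-minus-telescope u v w)))
        (coeff-mono-* (u ℤ.- v) e (v ℤ.- w) b q)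

ℕ[z] : Set
ℕ[z] = ℕ → ℕ

0ᶻ 1ᶻ : ℕ[z]
0ᶻ _ = 0
1ᶻ zero = 1
1ᶻ (suc _) = 0

infixl 6 _+ᶻ_
_+ᶻ_ : ℕ[z] → ℕ[z] → ℕ[z]
(p +ᶻ q) b = p b + q b

z·_ : ℕ[z] → ℕ[z]
(z· p) zero = 0
(z· p) (suc b) = p b

data Entry : Set where
  0ₑ 1ₑ zₑ : Entry

_∙_ : Entry → ℕ[z] → ℕ[z]
0ₑ ∙ p = 0ᶻ
1ₑ ∙ p = p
zₑ ∙ p = z· p

y^_·_ : ℤ → Entry → Poly
y^ a · 0ₑ = 0P
y^ a · 1ₑ = mono (+ 1) a 0
y^ a · zₑ = mono (+ 1) a 1

weight : Fin 4 → ℤ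
weight 0F = + 0
weight 1F = + 1
weight 2F = + 1
weight 3F = + 0

B : Fin 4 → Fin 4 → Entry
B 0F 1F = 1ₑ
B 0F 2F = zₑ
B 1F 0F = 1ₑ
B 1F 3F = zₑ
B 2F 0F = 1ₑ
B 3F 1F = 1ₑ
B _  _  = 0ₑ

A≡y^weight·B : ∀ i j → A i j ≡ y^ (weight i ℤ.- weight j) · B i j
A≡y^weight·B 0F 0F = refl
A≡y^weight·B 0F 1F = refl
A≡y^weight·B 0F 2F = refl
A≡y^weight·B 0F 3F = refl
A≡y^weight·B 1F 0F = refl
A≡y^weight·B 1F 1F = refl
A≡y^weight·B 1F 2F = refl
A≡y^weight·B 1F 3F = refl
A≡y^weight·B 2F 0F = refl
A≡y^weight·B 2F 1F = refl
A≡y^weight·B 2F 2F = refl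
A≡y^weight·B 2F 3F = refl
A≡y^weight·B 3F 0F = refl
A≡y^weight·B 3F 1F = refl
A≡y^weight·B 3F 2F = refl
A≡y^weight·B 3F 3F = refl

coeff-y^·-* : ∀ u v w e q (p : ℕ[z]) → (∀ b → coeff (v ℤ.- w) b q ≡ + p b) →
  ∀ b → coeff (u ℤ.- w) b ((y^ (u ℤ.- v) · e) *P q) ≡ + (e ∙ p) b
coeff-y^·-* u v w 0ₑ q p q≡p b       = refl
coeff-y^·-* u v w 1ₑ q p q≡p b       = trans (coeff-mono-*-telescope u v w 0 b q) (q≡p b)
coeff-y^·-* u v w zₑ q p q≡p zero    = coeff-mono-*-below (u ℤ.- v) 1 (u ℤ.- w) 0 q (s≤s z≤n)
coeff-y^·-* u v w zₑ q p q≡p (suc b) = trans (coeff-mono-*-telescope u v w 1 b q) (q≡p b)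

Column : Set
Column = Fin 4 → ℕ[z]

B*_ : Column → Column
(B* c) i = B i 0F ∙ c 0F +ᶻ (B i 1F ∙ c 1F +ᶻ (B i 2F ∙ c 2F +ᶻ B i 3F ∙ c 3F))

unit : Fin 4 → Column
unit l i = if does (i ≟ l) then 1ᶻ else 0ᶻ

-- column k l is the l-th column of B^k
column : ℕ → Fin 4 → Column
column zero    l = unit l
column (suc k) l = B* column k l

coeff-1P : ∀ b → coeff (+ 0) b 1P ≡ + 1ᶻ b
coeff-1P zero    = refl
coeff-1P (suc b) = refl

coeff-idM : ∀ i l b → coeff (weight i ℤ.- weight l) b (idM i l) ≡ + unit l i b
coeff-idM 0F            0F              = coeff-1P
coeff-idM 0F            (suc _)       b = refl
coeff-idM (suc _)       0F            b = refl
coeff-idM 1F            1F              = coeff-1P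
coeff-idM 1F            (suc (suc _)) b = refl
coeff-idM (suc (suc _)) 1F            b = refl
coeff-idM 2F            2F              = coeff-1P
coeff-idM 2F            3F            b = refl
coeff-idM 3F            2F            b = refl
coeff-idM 3F            3F              = coeff-1P

coeff-A^M : ∀ k i l b → coeff (weight i ℤ.- weight l) b ((A ^M k) i l) ≡ + column k l i b
coeff-A^M zero    i l b = coeff-idM i l b
coeff-A^M (suc k) i l b =
  trans (coeff-sum4 _ b (λ j → A i j *P (A ^M k) j l))
        (cong₂ ℤ._+_ (entry 0F) (cong₂ ℤ._+_ (entry 1F) (cong₂ ℤ._+_ (entry 2F) (entry 3F))))
  where
  entry : ∀ j → coeff (weight i ℤ.- weight l) b (A i j *P (A ^M k) j l) ≡ + (B i j ∙ column k l j) b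
  entry j = trans (cong (λ a → coeff (weight i ℤ.- weight l) b (a *P (A ^M k) j l)) (A≡y^weight·B i j))
                  (coeff-y^·-* (weight i) (weight j) (weight l) (B i j) _ _ (coeff-A^M k j l) b)

trᴮ : ℕ → ℕ[z]
trᴮ k = column k 0F 0F +ᶻ (column k 1F 1F +ᶻ (column k 2F 2F +ᶻ column k 3F 3F))

coeff-tr-A^M : ∀ k b → coeff (+ 0) b (tr (A ^M k)) ≡ + trᴮ k b
coeff-tr-A^M k b =
  trans (coeff-sum4 (+ 0) b (λ i → (A ^M k) i i))
        (cong₂ ℤ._+_ (coeff-A^M k 0F 0F b)
          (cong₂ ℤ._+_ (coeff-A^M k 1F 1F b) (cong₂ ℤ._+_ (coeff-A^M k 2F 2F b) (coeff-A^M k 3F 3F b))))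

infix 4 _≈_
_≈_ : Column → Column → Set
c ≈ d = ∀ i b → c i b ≡ d i b

≈-trans : ∀ {c d e} → c ≈ d → d ≈ e → c ≈ e
≈-trans c≈d d≈e i b = trans (c≈d i b) (d≈e i b)

∙-cong : ∀ e {p q : ℕ[z]} → (∀ b → p b ≡ q b) → ∀ b → (e ∙ p) b ≡ (e ∙ q) b
∙-cong 0ₑ p≡q b       = refl
∙-cong 1ₑ p≡q b       = p≡q b
∙-cong zₑ p≡q zero    = refl
∙-cong zₑ p≡q (suc b) = p≡q b

B*-cong : ∀ {c d} → c ≈ d → B* c ≈ B* d
B*-cong c≈d i b =
  cong₂ _+_ (∙-cong (B i 0F) (c≈d 0F) b)
    (cong₂ _+_ (∙-cong (B i 1F) (c≈d 1F) b)
      (cong₂ _+_ (∙-cong (B i 2F) (c≈d 2F) b) (∙-cong (B i 3F) (c≈d 3F) b)))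

data Side : Set where
  outer inner : Side

opposite : Side → Side
opposite outer = inner
opposite inner = outer

spread : Side → ℕ[z] → ℕ[z] → Column
spread outer p q 0F = p
spread outer p q 1F = 0ᶻ
spread outer p q 2F = 0ᶻ
spread outer p q 3F = q
spread inner p q 0F = 0ᶻ
spread inner p q 1F = p
spread inner p q 2F = q
spread inner p q 3F = 0ᶻ

z·0ᶻ : ∀ b → (z· 0ᶻ) b ≡ 0
z·0ᶻ zero    = refl
z·0ᶻ (suc b) = refl

B*-spread : ∀ s p q → B* spread s p q ≈ spread (opposite s) (p +ᶻ z· q) p
B*-spread outer p q 0F b = cong (_+ 0) (z·0ᶻ b)
B*-spread outer p q 1F b = refl
B*-spread outer p q 2F b = ℕP.+-identityʳ (p b)
B*-spread outer p q 3F b = refl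
B*-spread inner p q 0F b = cong (_+_ (p b)) (ℕP.+-identityʳ ((z· q) b))
B*-spread inner p q 1F b = z·0ᶻ b
B*-spread inner p q 2F b = refl
B*-spread inner p q 3F b = ℕP.+-identityʳ (p b)

B*²-spread : ∀ s p q → B* B* spread s p q ≈ spread s (p +ᶻ z· q +ᶻ z· p) (p +ᶻ z· q)
B*²-spread outer p q = ≈-trans (B*-cong (B*-spread outer p q)) (B*-spread inner _ _)
B*²-spread inner p q = ≈-trans (B*-cong (B*-spread inner p q)) (B*-spread outer _ _)

fib : ℕ[z] → ℕ[z] → ℕ → ℕ[z]
fib x₁ x₀ zero          = x₀
fib x₁ x₀ (suc zero)    = x₁
fib x₁ x₀ (suc (suc m)) = fib x₁ x₀ (suc m) +ᶻ z· fib x₁ x₀ m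

column-even : ∀ s l x₁ x₀ → unit l ≈ spread s x₁ x₀ →
  ∀ n → column (2 * n) l ≈ spread s (fib x₁ x₀ (suc (2 * n))) (fib x₁ x₀ (2 * n))
column-even s l x₁ x₀ l≈ zero = l≈
column-even s l x₁ x₀ l≈ (suc n) =
  subst (λ k → column k l ≈ spread s (fib x₁ x₀ (suc k)) (fib x₁ x₀ k)) (sym (ℕP.*-suc 2 n))
        (≈-trans (B*-cong (B*-cong (column-even s l x₁ x₀ l≈ n))) (B*²-spread s _ _))

-- Fibonacci polynomials F, and Lucas polynomials L N = F (N + 1) + z F (N - 1).
F G L : ℕ → ℕ[z]
F = fib 1ᶻ 0ᶻ
G = fib 0ᶻ 1ᶻ
L N = F (suc N) +ᶻ G N

trᴮ-even : ∀ n b → trᴮ (2 * n) b ≡ 2 * L (2 * n) b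
trᴮ-even n b = begin
  trᴮ (2 * n) b
    ≡⟨ cong₂ _+_ (c₀ 0F b) (cong₂ _+_ (c₁ 1F b) (cong₂ _+_ (c₂ 2F b) (c₃ 3F b))) ⟩
  f + (f + (g + g))
    ≡⟨ solve 2 (λ f g → f :+ (f :+ (g :+ g)) := con 2 :* (f :+ g)) refl f g ⟩
  2 * (f + g) ∎
  where
  open ≡-Reasoning
  f = F (suc (2 * n)) b
  g = G (2 * n) b
  c₀ = column-even outer 0F 1ᶻ 0ᶻ (λ { 0F _ → refl ; 1F _ → refl ; 2F _ → refl ; 3F _ → refl }) n
  c₁ = column-even inner 1F 1ᶻ 0ᶻ (λ { 0F _ → refl ; 1F _ → refl ; 2F _ → refl ; 3F _ → refl }) n
  c₂ = column-even inner 2F 0ᶻ 1ᶻ (λ { 0F _ → refl ; 1F _ → refl ; 2F _ → refl ; 3F _ → refl }) n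
  c₃ = column-even outer 3F 0ᶻ 1ᶻ (λ { 0F _ → refl ; 1F _ → refl ; 2F _ → refl ; 3F _ → refl }) n

[1+m∸j]C[1+j]≡[m∸j]C[1+j]+[m∸j]Cj : ∀ m j → (suc m ∸ j) C suc j ≡ (m ∸ j) C suc j + (m ∸ j) C j
[1+m∸j]C[1+j]≡[m∸j]C[1+j]+[m∸j]Cj m j with j ℕP.≤? m
... | yes j≤m rewrite ℕP.+-∸-assoc 1 j≤m =
  trans (sym (nCk+nC[k+1]≡[n+1]C[k+1] (m ∸ j) j)) (ℕP.+-comm ((m ∸ j) C j) _)
... | no j≰m rewrite ℕP.m≤n⇒m∸n≡0 (ℕP.≰⇒> j≰m) | ℕP.m≤n⇒m∸n≡0 (ℕP.<⇒≤ (ℕP.≰⇒> j≰m)) = 0≡0Cj j j≰m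
  where
  0≡0Cj : ∀ j → ¬ j ≤ m → 0 ≡ 0 C j
  0≡0Cj zero    j≰m = contradiction z≤n j≰m
  0≡0Cj (suc j) _   = refl

F-binomial : ∀ m j → F (suc m) j ≡ (m ∸ j) C j
F-binomial zero          zero          = refl
F-binomial zero          (suc j)       = refl
F-binomial (suc zero)    zero          = refl
F-binomial (suc zero)    (suc zero)    = refl
F-binomial (suc zero)    (suc (suc j)) = refl
F-binomial (suc (suc m)) zero          = cong (_+ 0) (F-binomial (suc m) zero)
F-binomial (suc (suc m)) (suc j)       =
  trans (cong₂ _+_ (F-binomial (suc m) (suc j)) (F-binomial m j))
        (sym ([1+m∸j]C[1+j]≡[m∸j]C[1+j]+[m∸j]Cj m j))

G≡z·F : ∀ m j → G (suc m) j ≡ (z· F m) j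
G≡z·F zero          zero    = refl
G≡z·F zero          (suc j) = refl
G≡z·F (suc zero)    j       = refl
G≡z·F (suc (suc m)) zero    = cong (_+ 0) (G≡z·F (suc m) zero)
G≡z·F (suc (suc m)) (suc j) = cong₂ _+_ (G≡z·F (suc m) (suc j)) (G≡z·F m j)

[k+1]*[n+1]C[k+1]≡[n+1]*nCk : ∀ n k → suc k * (suc n C suc k) ≡ suc n * (n C k)
[k+1]*[n+1]C[k+1]≡[n+1]*nCk n zero =
  trans (ℕP.+-identityʳ _) (trans (nC1≡n (suc n)) (sym (ℕP.*-identityʳ (suc n))))
[k+1]*[n+1]C[k+1]≡[n+1]*nCk zero (suc k) = ℕP.*-zeroʳ (suc (suc k))
[k+1]*[n+1]C[k+1]≡[n+1]*nCk (suc n) (suc k) = begin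
  suc (suc k) * (suc (suc n) C suc (suc k))
    ≡⟨ cong (suc (suc k) *_) (sym (nCk+nC[k+1]≡[n+1]C[k+1] (suc n) (suc k))) ⟩
  suc (suc k) * (P + Q)
    ≡⟨ solve 3 (λ k P Q → (con 2 :+ k) :* (P :+ Q) := P :+ ((con 1 :+ k) :* P :+ (con 2 :+ k) :* Q)) refl k P Q ⟩
  P + (suc k * P + suc (suc k) * Q)
    ≡⟨ cong (_+_ P) (cong₂ _+_ ([k+1]*[n+1]C[k+1]≡[n+1]*nCk n k) ([k+1]*[n+1]C[k+1]≡[n+1]*nCk n (suc k))) ⟩
  P + (suc n * (n C k) + suc n * (n C suc k))
    ≡⟨ cong (_+_ P) (sym (ℕP.*-distribˡ-+ (suc n) (n C k) (n C suc k))) ⟩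
  P + suc n * (n C k + n C suc k)
    ≡⟨ cong (λ x → P + suc n * x) (nCk+nC[k+1]≡[n+1]C[k+1] n k) ⟩
  suc (suc n) * P ∎
  where
  open ≡-Reasoning
  P = suc n C suc k
  Q = suc n C suc (suc k)

[N∸j]*LNj≡N*[N∸j]Cj : ∀ N j → (N ∸ j) * L N j ≡ N * ((N ∸ j) C j)
[N∸j]*LNj≡N*[N∸j]Cj zero          zero          = refl
[N∸j]*LNj≡N*[N∸j]Cj zero          (suc j)       = refl
[N∸j]*LNj≡N*[N∸j]Cj (suc m)       zero          =
  cong (suc m *_) (cong₂ _+_ (F-binomial (suc m) zero) (G≡z·F m zero))
[N∸j]*LNj≡N*[N∸j]Cj (suc zero)    (suc zero)    = refl
[N∸j]*LNj≡N*[N∸j]Cj (suc zero)    (suc (suc j)) = refl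
[N∸j]*LNj≡N*[N∸j]Cj (suc (suc m)) (suc j) with j ℕP.≤? m
... | no j≰m rewrite ℕP.m≤n⇒m∸n≡0 (ℕP.≰⇒> j≰m) = sym (ℕP.*-zeroʳ (suc (suc m)))
... | yes j≤m = begin
  (suc m ∸ j) * (F (suc (suc (suc m))) (suc j) + G (suc (suc m)) (suc j))
    ≡⟨ cong ((suc m ∸ j) *_) (cong₂ _+_ (F-binomial (suc (suc m)) (suc j))
                                         (trans (G≡z·F (suc m) (suc j)) (F-binomial m j))) ⟩
  (suc m ∸ j) * ((suc m ∸ j) C suc j + w C j)
    ≡⟨ cong (λ x → x * (x C suc j + w C j)) 1+m∸j≡1+w ⟩
  suc w * (suc w C suc j + w C j)
    ≡⟨ ℕP.*-distribˡ-+ (suc w) _ (w C j) ⟩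
  suc w * (suc w C suc j) + suc w * (w C j)
    ≡⟨ cong (_+_ (suc w * (suc w C suc j))) (sym ([k+1]*[n+1]C[k+1]≡[n+1]*nCk w j)) ⟩
  suc w * (suc w C suc j) + suc j * (suc w C suc j)
    ≡⟨ sym (ℕP.*-distribʳ-+ (suc w C suc j) (suc w) (suc j)) ⟩
  (suc w + suc j) * (suc w C suc j)
    ≡⟨ cong₂ (λ x y → x * (y C suc j)) w+j≡m (sym 1+m∸j≡1+w) ⟩
  suc (suc m) * ((suc m ∸ j) C suc j) ∎
  where
  open ≡-Reasoning
  w = m ∸ j
  1+m∸j≡1+w : suc m ∸ j ≡ suc w
  1+m∸j≡1+w = ℕP.+-∸-assoc 1 j≤m
  w+j≡m : suc w + suc j ≡ suc (suc m)
  w+j≡m = cong suc (trans (ℕP.+-suc w j) (cong suc (ℕP.m∸n+n≡m j≤m)))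

2X/1≡2*[m/N]*c : ∀ X m c N .{{_ : NonZero N}} → N * X ≡ m * c →
  (+ (2 * X)) / 1 ≡ ((+ 2) / 1) *ℚ ((+ m) / N) *ℚ ((+ c) / 1)
2X/1≡2*[m/N]*c X m c N@(suc N-1) N*X≡m*c = ℚP.toℚᵘ-injective unnormalised
  where
  -- 1 * N * 1 is the denominator of the unnormalised product of 2/1, m/N and c/1.
  cross : + (2 * X) ℤ.* + (1 * N * 1) ≡ (+ 2 ℤ.* + m) ℤ.* + c ℤ.* + 1
  cross = begin
    + (2 * X) ℤ.* + (1 * N * 1)      ≡⟨ ℤP.pos-* (2 * X) (1 * N * 1) ⟨
    + (2 * X * (1 * N * 1))          ≡⟨ cong +_ (solve 2 (λ X N → con 2 :* X :* (con 1 :* N :* con 1) := con 2 :* (N :* X)) refl X N) ⟩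
    + (2 * (N * X))                  ≡⟨ cong (λ x → + (2 * x)) N*X≡m*c ⟩
    + (2 * (m * c))                  ≡⟨ cong +_ (solve 2 (λ m c → con 2 :* (m :* c) := con 2 :* m :* c :* con 1) refl m c) ⟩
    + (2 * m * c * 1)                ≡⟨ ℤP.pos-* (2 * m * c) 1 ⟩
    + (2 * m * c) ℤ.* + 1            ≡⟨ cong (ℤ._* + 1) (ℤP.pos-* (2 * m) c) ⟩
    + (2 * m) ℤ.* + c ℤ.* + 1        ≡⟨ cong (λ x → x ℤ.* + c ℤ.* + 1) (ℤP.pos-* 2 m) ⟩
    (+ 2 ℤ.* + m) ℤ.* + c ℤ.* + 1    ∎
    where
    open ≡-Reasoning
  unnormalised : toℚᵘ ((+ (2 * X)) / 1) ≃ᵘ toℚᵘ (((+ 2) / 1) *ℚ ((+ m) / N) *ℚ ((+ c) / 1))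
  unnormalised = begin
    toℚᵘ ((+ (2 * X)) / 1)
      ≈⟨ ℚP.toℚᵘ-fromℚᵘ (mkℚᵘ (+ (2 * X)) 0) ⟩
    mkℚᵘ (+ (2 * X)) 0
      ≈⟨ *≡* cross ⟩
    mkℚᵘ (+ 2) 0 *ᵘ mkℚᵘ (+ m) N-1 *ᵘ mkℚᵘ (+ c) 0
      ≈⟨ ℚᵘP.*-cong (ℚᵘP.*-cong (ℚP.toℚᵘ-fromℚᵘ (mkℚᵘ (+ 2) 0)) (ℚP.toℚᵘ-fromℚᵘ (mkℚᵘ (+ m) N-1)))
                    (ℚP.toℚᵘ-fromℚᵘ (mkℚᵘ (+ c) 0)) ⟨
    toℚᵘ ((+ 2) / 1) *ᵘ toℚᵘ ((+ m) / N) *ᵘ toℚᵘ ((+ c) / 1)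
      ≈⟨ ℚᵘP.*-congʳ (ℚP.toℚᵘ-homo-* ((+ 2) / 1) ((+ m) / N)) ⟨
    toℚᵘ (((+ 2) / 1) *ℚ ((+ m) / N)) *ᵘ toℚᵘ ((+ c) / 1)
      ≈⟨ ℚP.toℚᵘ-homo-* (((+ 2) / 1) *ℚ ((+ m) / N)) ((+ c) / 1) ⟨
    toℚᵘ (((+ 2) / 1) *ℚ ((+ m) / N) *ℚ ((+ c) / 1)) ∎
    where open ℚᵘP.≃-Reasoning

lemma1 : (n j : ℕ) (h2 : 2 ≤ n) (hj : j ≤ n) →
    (coeff (+ 0) j (tr (A ^M (2 * n))) / 1)
    ≡ ((+ 2) / 1) *ℚ (_/_ (+ (2 * n)) (2 * n ∸ j) {{2n∸j-nonZero n j h2 hj}}) *ℚ ((+ ((2 * n ∸ j) C j)) / 1)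
lemma1 n j h2 hj = begin
  coeff (+ 0) j (tr (A ^M (2 * n))) / 1
    ≡⟨ cong (_/ 1) (trans (coeff-tr-A^M (2 * n) j) (cong +_ (trᴮ-even n j))) ⟩
  (+ (2 * L (2 * n) j)) / 1
    ≡⟨ 2X/1≡2*[m/N]*c _ (2 * n) ((2 * n ∸ j) C j) (2 * n ∸ j) {{2n∸j-nonZero n j h2 hj}} ([N∸j]*LNj≡N*[N∸j]Cj (2 * n) j) ⟩
  ((+ 2) / 1) *ℚ (_/_ (+ (2 * n)) (2 * n ∸ j) {{2n∸j-nonZero n j h2 hj}}) *ℚ ((+ ((2 * n ∸ j) C j)) / 1) ∎
  where open ≡-Reasoning
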